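{- Let $M$ be a reflexible map. Then the parallel product $N$ of all (pairwise non-isomorphic) maps obtained from $M$ by applying compositions of the operations $\mathrm{Du}$ and $\mathrm{Pe}$ is totally symmetric, and it is the unique minimal totally symmetric cover of $M$: every totally symmetric map covering $M$ is a cover of $N$.
   Context: Let $F=\langle t,l,r\mid t^2=l^2=r^2=(tl)^2=1\rangle$. A (finite rooted) map is a quadruple $M=(f,G,Z,\mathrm{id})$, where $Z$ is a finite set of flags, $G$ is a group acting on $Z$ on the right, transitively and faithfully, $f:F\to G$ is an epimorphism, and $\mathrm{id}\in Z$ is the root. A morphism $(\phi,\psi):M\to N$ is a group epimorphism $\psi:\mathrm{Mon}(M)\to\mathrm{Mon}(N)$ with $\psi\circ f_M=f_N$ and a surjection $\phi$ of flags with $\phi(\mathrm{id}_M)=\mathrm{id}_N$, $\phi(z\cdot g)=\phi(z)\cdot\psi(g)$; then $M$ is a cover of $N$; an isomorphism is a morphism with both components bijective. An automorphism of $M$ is a bijection $\alpha:Z\to Z$ with $\alpha(z\cdot g)=\alpha(z)\cdot g$; $M$ is reflexible if $\mathrm{Aut}(M)$ acts regularly on $Z$. With $\mathbf{du}:t\mapsto l,l\mapsto t,r\mapsto r$ and $\mathbf{pe}:t\mapsto t,l\mapsto lt,r\mapsto r$ (automorphisms of $F$), $\mathrm{Du}(M)=(f\circ\mathbf{du},G,Z,\mathrm{id})$ and $\mathrm{Pe}(M)=(f\circ\mathbf{pe},G,Z,\mathrm{id})$. Parallel product: $M_1\parallel M_2=(f_{1,2},K,X,(\mathrm{id}_1,\mathrm{id}_2))$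 with $f_{1,2}=(f_1,f_2)$, $K=f_{1,2}(F)$, $X$ the $K$-orbit of $(\mathrm{id}_1,\mathrm{id}_2)$ in $Z_1\times Z_2$ (associative and commutative up to isomorphism). A map $N$ is totally symmetric if it is reflexible and $\mathrm{Du}(N)$ and $\mathrm{Pe}(N)$ are both isomorphic to $N$. -}

module Defs where

open import Level using (0ℓ)
open import Data.Bool using (Bool; true; false; not)
open import Data.Nat using (ℕ; zero; suc)
open import Data.Fin using (Fin; zero; suc)
open import Data.List using (List; []; _∷_; _++_; reverse; map; [_])
open import Data.List.Properties using (++-assoc; ++-identityʳ; reverse-++; unfold-reverse)
open import Data.Product using (Σ; ∃; _×_; _,_; proj₁; proj₂)
open import Relation.Nullary using (¬_)
open import Relation.Binary.Bundles using (Setoid)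
open import Relation.Binary.PropositionalEquality as ≡ using (_≡_)
open import Algebra.Bundles using (Group)
open import Algebra.Morphism.Structures using (module GroupMorphisms)
open import Function.Bundles using (Bijection)
import Algebra.Properties.Group as GP
import Relation.Binary.Reasoning.Setoid as SR

-- The group F = ⟨ t, l, r ∣ t² = l² = r² = (tl)² = 1 ⟩.
-- An element of F is represented by a word in the generators and their
-- formal inverses (a letter (x , true) stands for x⁻¹).  A homomorphism
-- f : F → G is given by the images of the generators (satisfying the
-- relations, see IsMap); its value on a word is `eval`.

data Gen : Set where
  gt gl gr : Gen

Letter : Set
Letter = Gen × Bool

FWord : Set
FWord = List Letter

module _ (G : Group 0ℓ 0ℓ) (gen : Gen → Group.Carrier G) where
  open Group G
  evalL : Letter → Carrier
  evalL (x , false) = gen x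
  evalL (x , true)  = gen x ⁻¹

  eval : FWord → Carrier
  eval []      = ε
  eval (a ∷ w) = evalL a ∙ eval w

record RawMap : Set₁ where
  field
    G    : Group 0ℓ 0ℓ
  open Group G public
  field
    gen  : Gen → Carrier
    Z    : Setoid 0ℓ 0ℓ
  open Setoid Z public renaming (Carrier to Flag; _≈_ to _≈Z_;
    refl to reflZ; sym to symZ; trans to transZ; isEquivalence to isEquivalenceZ;
    reflexive to reflexiveZ; rawSetoid to rawSetoidZ; _≉_ to _≉Z_; isPartialEquivalence to isPartialEquivalenceZ;
    partialSetoid to partialSetoidZ)
  field
    act      : Flag → Carrier → Flag
    act-cong : ∀ {z z′ g g′} → z ≈Z z′ → g ≈ g′ → act z g ≈Z act z′ g′
    act-ε    : ∀ z → act z ε ≈Z z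
    act-∙    : ∀ z g h → act z (g ∙ h) ≈Z act (act z g) h
    root     : Flag

  f : FWord → Carrier
  f = eval G gen

record IsMap (M : RawMap) : Set where
  open RawMap M
  field
    rel-t  : gen gt ∙ gen gt ≈ ε
    rel-l  : gen gl ∙ gen gl ≈ ε
    rel-r  : gen gr ∙ gen gr ≈ ε
    rel-tl : (gen gt ∙ gen gl) ∙ (gen gt ∙ gen gl) ≈ ε
    epi        : ∀ g → ∃ λ w → f w ≈ g
    transitive : ∀ z → ∃ λ g → act root g ≈Z z
    faithful   : ∀ g → (∀ z → act z g ≈Z z) → g ≈ ε

FiniteMap : RawMap → Set
FiniteMap M = ∃ λ (n : ℕ) → Bijection (RawMap.Z M) (≡.setoid (Fin n))

record Morphism (M N : RawMap) : Set where
  private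
    module M = RawMap M
    module N = RawMap N
  open GroupMorphisms M.rawGroup N.rawGroup
  field
    ψ        : M.Carrier → N.Carrier
    ψ-hom    : IsGroupHomomorphism ψ
    ψ-surj   : ∀ h → ∃ λ g → ψ g N.≈ h
    ψ∘f      : ∀ w → ψ (M.f w) N.≈ N.f w
    φ        : M.Flag → N.Flag
    φ-cong   : ∀ {x y} → x M.≈Z y → φ x N.≈Z φ y
    φ-surj   : ∀ y → ∃ λ x → φ x N.≈Z y
    φ-root   : φ M.root N.≈Z N.root
    φ-act    : ∀ z g → φ (M.act z g) N.≈Z N.act (φ z) (ψ g)

Covers : RawMap → RawMap → Set
Covers M N = Morphism M N

record Isomorphism (M N : RawMap) : Set where
  private
    module M = RawMap M
    module N = RawMap N
  field
    morphism : Morphism M N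
  open Morphism morphism
  field
    ψ-inj : ∀ {g h} → ψ g N.≈ ψ h → g M.≈ h
    φ-inj : ∀ {x y} → φ x N.≈Z φ y → x M.≈Z y

record Automorphism (M : RawMap) : Set where
  open RawMap M
  field
    α       : Flag → Flag
    α-cong  : ∀ {x y} → x ≈Z y → α x ≈Z α y
    α-inj   : ∀ {x y} → α x ≈Z α y → x ≈Z y
    α-surj  : ∀ y → ∃ λ x → α x ≈Z y
    α-act   : ∀ z g → α (act z g) ≈Z act (α z) g

Reflexible : RawMap → Set
Reflexible M =
  (∀ x y → Σ (Automorphism M) λ a → Automorphism.α a x ≈Z y) ×
  (∀ (a b : Automorphism M) x → Automorphism.α a x ≈Z Automorphism.α b x →
      ∀ z → Automorphism.α a z ≈Z Automorphism.α b z)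
  where open RawMap M

Du : RawMap → RawMap
Du M = record M { gen = g′ }
  where
  open RawMap M
  g′ : Gen → Carrier
  g′ gt = gen gl
  g′ gl = gen gt
  g′ gr = gen gr

Pe : RawMap → RawMap
Pe M = record M { gen = g′ }
  where
  open RawMap M
  g′ : Gen → Carrier
  g′ gt = gen gt
  g′ gl = gen gl ∙ gen gt
  g′ gr = gen gr

TotallySymmetric : RawMap → Set
TotallySymmetric N = Reflexible N × Isomorphism (Du N) N × Isomorphism (Pe N) N

data Op : Set where
  du pe : Op

applyOps : List Op → RawMap → RawMap
applyOps []        M = M
applyOps (du ∷ os) M = Du (applyOps os M)
applyOps (pe ∷ os) M = Pe (applyOps os M)

flipL : Letter → Letter
flipL (x , b) = (x , not b)

invW : FWord → FWord
invW []      = []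
invW (a ∷ w) = invW w ++ [ flipL a ]

module WordLemmas (G : Group 0ℓ 0ℓ) (gen : Gen → Group.Carrier G) where
  open Group G
  open GP G
  open SR setoid

  eval-++ : ∀ u v → eval G gen (u ++ v) ≈ eval G gen u ∙ eval G gen v
  eval-++ [] v = sym (identityˡ _)
  eval-++ (a ∷ u) v = trans (∙-congˡ (eval-++ u v)) (sym (assoc _ _ _))

  evalL-flip : ∀ a → evalL G gen (flipL a) ≈ evalL G gen a ⁻¹
  evalL-flip (x , false) = refl
  evalL-flip (x , true)  = sym (⁻¹-involutive _)

  eval-inv : ∀ w → eval G gen (invW w) ≈ eval G gen w ⁻¹
  eval-inv [] = sym ε⁻¹≈ε
  eval-inv (a ∷ w) = begin
    eval G gen (invW w ++ [ flipL a ])                    ≈⟨ eval-++ (invW w) [ flipL a ] ⟩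
    eval G gen (invW w) ∙ (evalL G gen (flipL a) ∙ ε)     ≈⟨ ∙-cong (eval-inv w) (trans (identityʳ _) (evalL-flip a)) ⟩
    eval G gen w ⁻¹ ∙ evalL G gen a ⁻¹                    ≈⟨ sym (⁻¹-anti-homo-∙ _ _) ⟩
    (evalL G gen a ∙ eval G gen w) ⁻¹                     ∎

-- K = f₁,₂(F) ≤ G₁ × G₂ is represented as F / ker f₁,₂ : words, two words
-- being equal iff their images under f₁,₂ = (f₁ , f₂) coincide
-- (so w ↦ f₁,₂(w) is an isomorphism of this group onto f₁,₂(F)).
-- X = orbit of (id₁ , id₂) is represented likewise: a word w stands for
-- the flag (id₁ , id₂)·f₁,₂(w), two words being equal iff these flags are.

_∥_ : RawMap → RawMap → RawMap
M₁ ∥ M₂ = record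
  { G        = K
  ; gen      = λ x → [ (x , false) ]
  ; Z        = X
  ; act      = _++_
  ; act-cong = λ {z} {z′} {g} {g′} → act-cong′ z z′ g g′
  ; act-ε    = λ z → ≡-X (++-identityʳ z)
  ; act-∙    = λ z g h → ≡-X (≡.sym (++-assoc z g h))
  ; root     = []
  }
  where
  module M₁ = RawMap M₁
  module M₂ = RawMap M₂
  module L₁ = WordLemmas M₁.G M₁.gen
  module L₂ = WordLemmas M₂.G M₂.gen

  _≈K_ : FWord → FWord → Set
  u ≈K v = (M₁.f u M₁.≈ M₁.f v) × (M₂.f u M₂.≈ M₂.f v)

  ≡-K : ∀ {u v} → u ≡ v → u ≈K v
  ≡-K ≡.refl = M₁.refl , M₂.refl

  K : Group 0ℓ 0ℓ
  K = record
    { Carrier = FWord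
    ; _≈_ = _≈K_
    ; _∙_ = _++_
    ; ε = []
    ; _⁻¹ = invW
    ; isGroup = record
      { isMonoid = record
        { isSemigroup = record
          { isMagma = record
            { isEquivalence = record
              { refl  = M₁.refl , M₂.refl
              ; sym   = λ (p , q) → M₁.sym p , M₂.sym q
              ; trans = λ (p , q) (p′ , q′) → M₁.trans p p′ , M₂.trans q q′
              }
            ; ∙-cong = λ {u} {u′} {v} {v′} (p , q) (p′ , q′) →
                M₁.trans (L₁.eval-++ u v) (M₁.trans (M₁.∙-cong p p′) (M₁.sym (L₁.eval-++ u′ v′))) ,
                M₂.trans (L₂.eval-++ u v) (M₂.trans (M₂.∙-cong q q′) (M₂.sym (L₂.eval-++ u′ v′)))
            }
          ; assoc = λ u v w → ≡-K (++-assoc u v w)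
          }
        ; identity = (λ w → ≡-K {w} {w} ≡.refl) , (λ w → ≡-K (++-identityʳ w))
        }
      ; inverse =
          (λ w → M₁.trans (L₁.eval-++ (invW w) w) (M₁.trans (M₁.∙-congʳ (L₁.eval-inv w)) (M₁.inverseˡ _)) ,
                 M₂.trans (L₂.eval-++ (invW w) w) (M₂.trans (M₂.∙-congʳ (L₂.eval-inv w)) (M₂.inverseˡ _))) ,
          (λ w → M₁.trans (L₁.eval-++ w (invW w)) (M₁.trans (M₁.∙-congˡ (L₁.eval-inv w)) (M₁.inverseʳ _)) ,
                 M₂.trans (L₂.eval-++ w (invW w)) (M₂.trans (M₂.∙-congˡ (L₂.eval-inv w)) (M₂.inverseʳ _)))
      ; ⁻¹-cong = λ {u} {v} (p , q) →
          M₁.trans (L₁.eval-inv u) (M₁.trans (M₁.⁻¹-cong p) (M₁.sym (L₁.eval-inv v))) ,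
          M₂.trans (L₂.eval-inv u) (M₂.trans (M₂.⁻¹-cong q) (M₂.sym (L₂.eval-inv v)))
      }
    }

  pt₁ : FWord → M₁.Flag
  pt₁ w = M₁.act M₁.root (M₁.f w)
  pt₂ : FWord → M₂.Flag
  pt₂ w = M₂.act M₂.root (M₂.f w)

  _≈X_ : FWord → FWord → Set
  u ≈X v = (pt₁ u M₁.≈Z pt₁ v) × (pt₂ u M₂.≈Z pt₂ v)

  ≡-X : ∀ {u v} → u ≡ v → u ≈X v
  ≡-X ≡.refl = M₁.reflZ , M₂.reflZ

  X : Setoid 0ℓ 0ℓ
  X = record
    { Carrier = FWord
    ; _≈_ = _≈X_
    ; isEquivalence = record
      { refl  = M₁.reflZ , M₂.reflZ
      ; sym   = λ (p , q) → M₁.symZ p , M₂.symZ q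
      ; trans = λ (p , q) (p′ , q′) → M₁.transZ p p′ , M₂.transZ q q′
      }
    }

  act-cong′ : ∀ z z′ g g′ → z ≈X z′ → g ≈K g′ → (z ++ g) ≈X (z′ ++ g′)
  act-cong′ z z′ g g′ (p , q) (p′ , q′) =
    M₁.transZ (M₁.act-cong M₁.reflZ (L₁.eval-++ z g))
      (M₁.transZ (M₁.act-∙ _ _ _)
        (M₁.transZ (M₁.act-cong p p′)
          (M₁.transZ (M₁.symZ (M₁.act-∙ _ _ _)) (M₁.act-cong M₁.reflZ (M₁.sym (L₁.eval-++ z′ g′)))))) ,
    M₂.transZ (M₂.act-cong M₂.reflZ (L₂.eval-++ z g))
      (M₂.transZ (M₂.act-∙ _ _ _)
        (M₂.transZ (M₂.act-cong q q′)
          (M₂.transZ (M₂.symZ (M₂.act-∙ _ _ _)) (M₂.act-cong M₂.reflZ (M₂.sym (L₂.eval-++ z′ g′))))))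

ParAll : (k : ℕ) → (Fin (suc k) → RawMap) → RawMap
ParAll zero    L = L zero
ParAll (suc k) L = L zero ∥ ParAll k (λ i → L (suc i))

{-# OPTIONS --safe #-}
module Submission where

open import Defs
open import Level using (0ℓ)
open import Data.Bool using (false; true)
open import Data.Nat using (ℕ; zero; suc)
open import Data.Fin using (Fin; zero; suc)
open import Data.List using (List; []; _∷_; _++_; [_]; concatMap)
open import Data.List.Properties using (++-assoc; concatMap-++)
open import Data.Product using (∃; _×_; _,_; proj₁; proj₂)
open import Function using (_∘_)
open import Function.Bundles using (_⇔_; mk⇔; Equivalence)
open import Relation.Nullary using (¬_)
open import Relation.Binary.Bundles using (Setoid)
open import Relation.Binary.PropositionalEquality as ≡ using (_≡_; _≢_)
open import Algebra.Bundles using (Group)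
open import Algebra.Morphism.Structures using (module GroupMorphisms)
import Algebra.Properties.Group as GroupProperties
import Relation.Binary.Reasoning.Setoid as SetoidReasoning

open Equivalence using (to; from)

-- A transitive map A is described by two equivalence relations on words of F:
-- u, v are identified as elements when f u = f v, and as flags when
-- id·f u = id·f v.  A cover A → B exists exactly when both relations of A
-- are contained in those of B (written A ⊑ B), and A ≅ B when they coincide.
-- The relations of a parallel product are the intersections of those of the
-- factors, so N is the meet of the Mᵢ for ⊑; those of Du A and Pe A are the
-- pullbacks of those of A along the substitutions du, pe of F; and A is
-- reflexible iff its flag relation is invariant under left multiplication,
-- a property that survives pullbacks and intersections.  Since du and pe are
-- involutions modulo t² = l² = (tl)² = 1, they permute the Mᵢ up to
-- isomorphism, so Du N ≅ N ≅ Pe N.  A totally symmetric cover M′ of M satisfies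
-- M′ ⊑ Op M′, so M′ ⊑ X implies M′ ⊑ Op X; hence M′ ⊑ Mᵢ for all i, and M′ ⊑ N.

data Kind : Set where
  elem flag : Kind

point : (A : RawMap) → FWord → RawMap.Flag A
point A w = RawMap.act A (RawMap.root A) (RawMap.f A w)

target : Kind → RawMap → Setoid 0ℓ 0ℓ
target elem A = RawMap.setoid A
target flag A = RawMap.Z A

image : ∀ κ A → FWord → Setoid.Carrier (target κ A)
image elem A = RawMap.f A
image flag A = point A

record Identifies (κ : Kind) (A : RawMap) (u v : FWord) : Set where
  constructor identifies
  field identified : Setoid._≈_ (target κ A) (image κ A u) (image κ A v)
open Identifies public

elem⇒flag : ∀ {A u v} → Identifies elem A u v → Identifies flag A u v
elem⇒flag {A} (identifies p) = identifies (RawMap.act-cong A (RawMap.reflZ A) p)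

infix 4 _⊑_
_⊑_ : RawMap → RawMap → Set
A ⊑ B = ∀ κ {u v} → Identifies κ A u v → Identifies κ B u v

⊑-trans : ∀ {A B C} → A ⊑ B → B ⊑ C → A ⊑ C
⊑-trans A⊑B B⊑C κ = B⊑C κ ∘ A⊑B κ

module _ (A : RawMap) where
  open RawMap A
  open WordLemmas G gen
  open GroupProperties G using (\\-leftDividesˡ; \\-leftDividesʳ; //-rightDividesˡ)

  point-++ : ∀ u v → point A (u ++ v) ≈Z act (point A u) (f v)
  point-++ u v = transZ (act-cong reflZ (eval-++ u v)) (act-∙ _ _ _)

  invW-++-cancel : ∀ c u → Identifies elem A (invW c ++ (c ++ u)) u
  invW-++-cancel c u = identifies (trans (eval-++ (invW c) (c ++ u))
    (trans (∙-cong (eval-inv c) (eval-++ c u)) (\\-leftDividesʳ (f c) (f u))))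

  ++-invW-cancel : ∀ c u → Identifies elem A (c ++ (invW c ++ u)) u
  ++-invW-cancel c u = identifies (trans (eval-++ c (invW c ++ u))
    (trans (∙-congˡ (trans (eval-++ (invW c) u) (∙-congʳ (eval-inv c)))) (\\-leftDividesˡ (f c) (f u))))

  ++-invW-++-cancel : ∀ u v → Identifies elem A ((u ++ invW v) ++ v) u
  ++-invW-++-cancel u v = identifies (trans (eval-++ (u ++ invW v) v)
    (trans (∙-congʳ (trans (eval-++ u (invW v)) (∙-congˡ (eval-inv v)))) (//-rightDividesˡ (f v) (f u))))

record Generated (A : RawMap) : Set where
  open RawMap A
  field
    elemWord      : Carrier → FWord
    elemWord-spec : ∀ g → f (elemWord g) ≈ g
    flagWord      : Flag → FWord
    flagWord-spec : ∀ z → point A (flagWord z) ≈Z z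

IsMap⇒Generated : ∀ {A} → IsMap A → Generated A
IsMap⇒Generated {A} isMap = record
  { elemWord      = λ g → proj₁ (epi g)
  ; elemWord-spec = λ g → proj₂ (epi g)
  ; flagWord      = λ z → proj₁ (epi (proj₁ (transitive z)))
  ; flagWord-spec = λ z → transZ (act-cong reflZ (proj₂ (epi _))) (proj₂ (transitive z))
  }
  where
  open RawMap A
  open IsMap isMap

module _ {A B : RawMap} where
  private
    module A = RawMap A
    module B = RawMap B

  φ-point : (m : Morphism A B) → ∀ w → Morphism.φ m (point A w) B.≈Z point B w
  φ-point m w = B.transZ (φ-act _ _) (B.act-cong φ-root (ψ∘f w))
    where open Morphism m

  morphism⇒⊑ : Morphism A B → A ⊑ B
  morphism⇒⊑ m elem {u} {v} (identifies p) =
    identifies (B.trans (B.sym (ψ∘f u)) (B.trans (⟦⟧-cong p) (ψ∘f v)))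
    where
    open Morphism m
    open GroupMorphisms.IsGroupHomomorphism ψ-hom using (⟦⟧-cong)
  morphism⇒⊑ m flag {u} {v} (identifies p) =
    identifies (B.transZ (B.symZ (φ-point m u)) (B.transZ (Morphism.φ-cong m p) (φ-point m v)))

  isomorphism⇒⊒ : Isomorphism A B → B ⊑ A
  isomorphism⇒⊒ i elem {u} {v} (identifies p) =
    identifies (ψ-inj (B.trans (ψ∘f u) (B.trans p (B.sym (ψ∘f v)))))
    where
    open Isomorphism i
    open Morphism morphism
  isomorphism⇒⊒ i flag {u} {v} (identifies p) =
    identifies (φ-inj (B.transZ (φ-point morphism u) (B.transZ p (B.symZ (φ-point morphism v)))))
    where open Isomorphism i

module _ {A B : RawMap} (genA : Generated A) (genB : Generated B) (A⊑B : A ⊑ B) where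
  private
    module A = RawMap A
    module B = RawMap B
    open Generated genA
    open GroupMorphisms A.rawGroup B.rawGroup
    module WA = WordLemmas A.G A.gen
    module WB = WordLemmas B.G B.gen

    ψ : A.Carrier → B.Carrier
    ψ g = B.f (elemWord g)

    ψ-spec : ∀ {g} w → A.f w A.≈ g → ψ g B.≈ B.f w
    ψ-spec {g} w p = identified (A⊑B elem {elemWord g} {w} (identifies (A.trans (elemWord-spec g) (A.sym p))))

    φ : A.Flag → B.Flag
    φ z = point B (flagWord z)

    φ-spec : ∀ {z} w → point A w A.≈Z z → φ z B.≈Z point B w
    φ-spec {z} w p = identified (A⊑B flag {flagWord z} {w} (identifies (A.transZ (flagWord-spec z) (A.symZ p))))

    ψ-hom : IsGroupHomomorphism ψ
    ψ-hom = record
      { isMonoidHomomorphism = record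
        { isMagmaHomomorphism = record
          { isRelHomomorphism = record
            { cong = λ {g} {h} g≈h → ψ-spec (elemWord h) (A.trans (elemWord-spec h) (A.sym g≈h)) }
          ; homo = λ g h → B.trans
              (ψ-spec (elemWord g ++ elemWord h)
                (A.trans (WA.eval-++ (elemWord g) (elemWord h)) (A.∙-cong (elemWord-spec g) (elemWord-spec h))))
              (WB.eval-++ (elemWord g) (elemWord h))
          }
        ; ε-homo = ψ-spec [] A.refl
        }
      ; ⁻¹-homo = λ g → B.trans
          (ψ-spec (invW (elemWord g)) (A.trans (WA.eval-inv (elemWord g)) (A.⁻¹-cong (elemWord-spec g))))
          (WB.eval-inv (elemWord g))
      }

  ⊑⇒Morphism : Morphism A B
  ⊑⇒Morphism = record
    { ψ      = ψ
    ; ψ-hom  = ψ-hom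
    ; ψ-surj = λ h → A.f (GB.elemWord h) , B.trans (ψ-spec (GB.elemWord h) A.refl) (GB.elemWord-spec h)
    ; ψ∘f    = λ w → ψ-spec w A.refl
    ; φ      = φ
    ; φ-cong = λ {x} {y} x≈y → φ-spec (flagWord y) (A.transZ (flagWord-spec y) (A.symZ x≈y))
    ; φ-surj = λ z → point A (GB.flagWord z) , B.transZ (φ-spec (GB.flagWord z) A.reflZ) (GB.flagWord-spec z)
    ; φ-root = B.transZ (φ-spec [] (A.act-ε _)) (B.act-ε _)
    ; φ-act  = λ z g → B.transZ
        (φ-spec (flagWord z ++ elemWord g)
          (A.transZ (point-++ A (flagWord z) (elemWord g)) (A.act-cong (flagWord-spec z) (elemWord-spec g))))
        (point-++ B (flagWord z) (elemWord g))
    }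
    where module GB = Generated genB

  ⊑⇒Isomorphism : B ⊑ A → Isomorphism A B
  ⊑⇒Isomorphism B⊑A = record
    { morphism = ⊑⇒Morphism
    ; ψ-inj = λ {g} {h} ψg≈ψh → A.trans (A.sym (elemWord-spec g))
        (A.trans (identified (B⊑A elem {elemWord g} {elemWord h} (identifies ψg≈ψh))) (elemWord-spec h))
    ; φ-inj = λ {x} {y} φx≈φy → A.transZ (A.symZ (flagWord-spec x))
        (A.transZ (identified (B⊑A flag {flagWord x} {flagWord y} (identifies φx≈φy))) (flagWord-spec y))
    }

LeftInvariant : RawMap → Set
LeftInvariant A = ∀ c {u v} → Identifies flag A u v → Identifies flag A (c ++ u) (c ++ v)

Reflexible⇒LeftInvariant : ∀ {A} → Reflexible A → LeftInvariant A
Reflexible⇒LeftInvariant {A} (transitive , _) c {u} {v} (identifies u~v) = identifies (begin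
  point A (c ++ u)        ≈⟨ point-++ A c u ⟩
  act (point A c) (f u)   ≈⟨ act-cong root↦c refl ⟨
  act (α root) (f u)      ≈⟨ α-act root (f u) ⟨
  α (point A u)           ≈⟨ α-cong u~v ⟩
  α (point A v)           ≈⟨ α-act root (f v) ⟩
  act (α root) (f v)      ≈⟨ act-cong root↦c refl ⟩
  act (point A c) (f v)   ≈⟨ point-++ A c v ⟨
  point A (c ++ v)        ∎)
  where
  open RawMap A
  open SetoidReasoning Z
  a : Automorphism A
  a = proj₁ (transitive root (point A c))
  open Automorphism a
  root↦c : α root ≈Z point A c
  root↦c = proj₂ (transitive root (point A c))

module _ {A : RawMap} (genA : Generated A) where
  open RawMap A
  open Generated genA
  open SetoidReasoning Z

  flagWord-point : ∀ w → Identifies flag A (flagWord (point A w)) w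
  flagWord-point w = identifies (flagWord-spec (point A w))

  flagWord-cong : ∀ {z z′} → z ≈Z z′ → Identifies flag A (flagWord z) (flagWord z′)
  flagWord-cong {z} {z′} z≈z′ = identifies (transZ (flagWord-spec z) (transZ z≈z′ (symZ (flagWord-spec z′))))

  act-between : ∀ x z → act x (f (invW (flagWord x) ++ flagWord z)) ≈Z z
  act-between x z = begin
    act x (f (invW wx ++ wz))                ≈⟨ act-cong (flagWord-spec x) refl ⟨
    act (point A wx) (f (invW wx ++ wz))     ≈⟨ point-++ A wx (invW wx ++ wz) ⟨
    point A (wx ++ (invW wx ++ wz))          ≈⟨ identified (elem⇒flag (++-invW-cancel A wx wz)) ⟩
    point A wz                               ≈⟨ flagWord-spec z ⟩
    z                                        ∎
    where
    wx wz : FWord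
    wx = flagWord x
    wz = flagWord z

  automorphisms-agree : ∀ (a b : Automorphism A) x → Automorphism.α a x ≈Z Automorphism.α b x →
    ∀ z → Automorphism.α a z ≈Z Automorphism.α b z
  automorphisms-agree a b x ax≈bx z = begin
    a.α z            ≈⟨ a.α-cong (act-between x z) ⟨
    a.α (act x g)    ≈⟨ a.α-act x g ⟩
    act (a.α x) g    ≈⟨ act-cong ax≈bx refl ⟩
    act (b.α x) g    ≈⟨ b.α-act x g ⟨
    b.α (act x g)    ≈⟨ b.α-cong (act-between x z) ⟩
    b.α z            ∎
    where
    module a = Automorphism a
    module b = Automorphism b
    g : Carrier
    g = f (invW (flagWord x) ++ flagWord z)

  module _ (invariant : LeftInvariant A) where
    translate : FWord → Flag → Flag
    translate c z = point A (c ++ flagWord z)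

    translate-cong : ∀ c {z z′} → z ≈Z z′ → translate c z ≈Z translate c z′
    translate-cong c z≈z′ = identified (invariant c (flagWord-cong z≈z′))

    translate-point : ∀ c w → translate c (point A w) ≈Z point A (c ++ w)
    translate-point c w = identified (invariant c (flagWord-point w))

    translate-invW-translate : ∀ c z → translate (invW c) (translate c z) ≈Z z
    translate-invW-translate c z = begin
      translate (invW c) (point A (c ++ flagWord z))   ≈⟨ translate-point (invW c) (c ++ flagWord z) ⟩
      point A (invW c ++ (c ++ flagWord z))            ≈⟨ identified (elem⇒flag (invW-++-cancel A c (flagWord z))) ⟩
      point A (flagWord z)                             ≈⟨ flagWord-spec z ⟩
      z                                                ∎

    translate-translate-invW : ∀ c z → translate c (translate (invW c) z) ≈Z z
    translate-translate-invW c z = begin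
      translate c (point A (invW c ++ flagWord z))     ≈⟨ translate-point c (invW c ++ flagWord z) ⟩
      point A (c ++ (invW c ++ flagWord z))            ≈⟨ identified (elem⇒flag (++-invW-cancel A c (flagWord z))) ⟩
      point A (flagWord z)                             ≈⟨ flagWord-spec z ⟩
      z                                                ∎

    translate-act : ∀ c z g → translate c (act z g) ≈Z act (translate c z) g
    translate-act c z g = begin
      translate c (act z g)                  ≈⟨ translate-cong c (act-cong (flagWord-spec z) (elemWord-spec g)) ⟨
      translate c (act (point A wz) (f wg))  ≈⟨ translate-cong c (point-++ A wz wg) ⟨
      translate c (point A (wz ++ wg))       ≈⟨ translate-point c (wz ++ wg) ⟩
      point A (c ++ (wz ++ wg))              ≡⟨ ≡.cong (point A) (≡.sym (++-assoc c wz wg)) ⟩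
      point A ((c ++ wz) ++ wg)              ≈⟨ point-++ A (c ++ wz) wg ⟩
      act (translate c z) (f wg)             ≈⟨ act-cong reflZ (elemWord-spec g) ⟩
      act (translate c z) g                  ∎
      where
      wz wg : FWord
      wz = flagWord z
      wg = elemWord g

    translation : FWord → Automorphism A
    translation c = record
      { α      = translate c
      ; α-cong = translate-cong c
      ; α-inj  = λ {z} {z′} cz≈cz′ → begin
          z                                   ≈⟨ translate-invW-translate c z ⟨
          translate (invW c) (translate c z)  ≈⟨ translate-cong (invW c) cz≈cz′ ⟩
          translate (invW c) (translate c z′) ≈⟨ translate-invW-translate c z′ ⟩
          z′                                  ∎
      ; α-surj = λ y → translate (invW c) y , translate-translate-invW c y
      ; α-act  = translate-act c
      }

    LeftInvariant⇒Reflexible : Reflexible A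
    LeftInvariant⇒Reflexible = (λ x y → translation (flagWord y ++ invW (flagWord x)) , translation-maps x y)
                             , automorphisms-agree
      where
      translation-maps : ∀ x y → translate (flagWord y ++ invW (flagWord x)) x ≈Z y
      translation-maps x y = transZ (identified (elem⇒flag (++-invW-++-cancel A (flagWord y) (flagWord x))))
                                    (flagWord-spec y)

∥-f : ∀ A B w → RawMap.f (A ∥ B) w ≡ w
∥-f A B []              = ≡.refl
∥-f A B ((x , false) ∷ w) = ≡.cong ((x , false) ∷_) (∥-f A B w)
∥-f A B ((x , true) ∷ w)  = ≡.cong ((x , true) ∷_) (∥-f A B w)

module _ (A B : RawMap) where
  private
    module AB = RawMap (A ∥ B)

  ∥-generated : Generated (A ∥ B)
  ∥-generated = record
    { elemWord      = λ w → w
    ; elemWord-spec = λ w → AB.reflexive (∥-f A B w)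
    ; flagWord      = λ w → w
    ; flagWord-spec = λ w → AB.reflexiveZ (∥-f A B w)
    }

  ∥-identifies : ∀ κ {u v} → Identifies κ (A ∥ B) u v ⇔ (Identifies κ A u v × Identifies κ B u v)
  ∥-identifies elem {u} {v} = mk⇔
    (λ (identifies p) → let (p₁ , p₂) = ≡.subst₂ AB._≈_ (∥-f A B u) (∥-f A B v) p
                        in identifies p₁ , identifies p₂)
    (λ (identifies p₁ , identifies p₂) →
      identifies (≡.subst₂ AB._≈_ (≡.sym (∥-f A B u)) (≡.sym (∥-f A B v)) (p₁ , p₂)))
  ∥-identifies flag {u} {v} = mk⇔
    (λ (identifies p) → let (p₁ , p₂) = ≡.subst₂ AB._≈Z_ (∥-f A B u) (∥-f A B v) p
                        in identifies p₁ , identifies p₂)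
    (λ (identifies p₁ , identifies p₂) →
      identifies (≡.subst₂ AB._≈Z_ (≡.sym (∥-f A B u)) (≡.sym (∥-f A B v)) (p₁ , p₂)))

ParAll-⊑ : ∀ k (L : Fin (suc k) → RawMap) i → ParAll k L ⊑ L i
ParAll-⊑ zero    L zero    κ p = p
ParAll-⊑ (suc k) L zero    κ p = proj₁ (to (∥-identifies (L zero) (ParAll k (L ∘ suc)) κ) p)
ParAll-⊑ (suc k) L (suc i) κ p =
  ParAll-⊑ k (L ∘ suc) i κ (proj₂ (to (∥-identifies (L zero) (ParAll k (L ∘ suc)) κ) p))

ParAll-identifies : ∀ k (L : Fin (suc k) → RawMap) κ {u v} →
  (∀ i → Identifies κ (L i) u v) → Identifies κ (ParAll k L) u v
ParAll-identifies zero    L κ h = h zero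
ParAll-identifies (suc k) L κ h =
  from (∥-identifies (L zero) (ParAll k (L ∘ suc)) κ) (h zero , ParAll-identifies k (L ∘ suc) κ (h ∘ suc))

⊑-ParAll : ∀ k (L : Fin (suc k) → RawMap) {A} → (∀ i → A ⊑ L i) → A ⊑ ParAll k L
⊑-ParAll k L A⊑L κ p = ParAll-identifies k L κ (λ i → A⊑L i κ p)

ParAll-generated : ∀ k (L : Fin (suc k) → RawMap) → Generated (L zero) → Generated (ParAll k L)
ParAll-generated zero    L gen₀ = gen₀
ParAll-generated (suc k) L _    = ∥-generated (L zero) (ParAll k (L ∘ suc))

ParAll-leftInvariant : ∀ k (L : Fin (suc k) → RawMap) →
  (∀ i → LeftInvariant (L i)) → LeftInvariant (ParAll k L)
ParAll-leftInvariant k L invariant c p =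
  ParAll-identifies k L flag (λ i → invariant i c (ParAll-⊑ k L i flag p))

substituteLetter : (Gen → FWord) → Letter → FWord
substituteLetter σ (x , false) = σ x
substituteLetter σ (x , true)  = invW (σ x)

substitute : (Gen → FWord) → FWord → FWord
substitute σ = concatMap (substituteLetter σ)

module _ (G : Group 0ℓ 0ℓ) (gen : Gen → Group.Carrier G) where
  open Group G
  open WordLemmas G gen

  eval-substitute : ∀ {gen′} σ → (∀ x → gen′ x ≈ eval G gen (σ x)) →
    ∀ w → eval G gen′ w ≈ eval G gen (substitute σ w)
  eval-substitute σ gen′≈ []      = refl
  eval-substitute σ gen′≈ (a ∷ w) =
    trans (∙-cong (letter a) (eval-substitute σ gen′≈ w)) (sym (eval-++ (substituteLetter σ a) (substitute σ w)))
    where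
    letter : ∀ a → evalL G _ a ≈ eval G gen (substituteLetter σ a)
    letter (x , false) = gen′≈ x
    letter (x , true)  = trans (⁻¹-cong (gen′≈ x)) (sym (eval-inv (σ x)))

  eval-cong : ∀ {gen′} → (∀ x → gen′ x ≈ gen x) → ∀ w → eval G gen′ w ≈ eval G gen w
  eval-cong gen′≈ []                = refl
  eval-cong gen′≈ ((x , false) ∷ w) = ∙-cong (gen′≈ x) (eval-cong gen′≈ w)
  eval-cong gen′≈ ((x , true) ∷ w)  = ∙-cong (⁻¹-cong (gen′≈ x)) (eval-cong gen′≈ w)

-- Du X and Pe X are definitionally of the form X′.
module Regenerated (X : RawMap) (gen′ : Gen → RawMap.Carrier X) where
  open RawMap X

  X′ : RawMap
  X′ = record X { gen = gen′ }

  transfer : (s : FWord → FWord) → (∀ w → RawMap.f X′ w ≈ f (s w)) →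
    ∀ κ {u v} → Identifies κ X′ u v ⇔ Identifies κ X (s u) (s v)
  transfer s f′≈ elem {u} {v} = mk⇔
    (λ (identifies p) → identifies (trans (sym (f′≈ u)) (trans p (f′≈ v))))
    (λ (identifies p) → identifies (trans (f′≈ u) (trans p (sym (f′≈ v)))))
  transfer s f′≈ flag {u} {v} = mk⇔
    (λ (identifies p) → identifies (transZ (symZ (point′≈ u)) (transZ p (point′≈ v))))
    (λ (identifies p) → identifies (transZ (point′≈ u) (transZ p (symZ (point′≈ v)))))
    where
    point′≈ : ∀ w → point X′ w ≈Z point X (s w)
    point′≈ w = act-cong reflZ (f′≈ w)

  pullback : ∀ σ → (∀ x → gen′ x ≈ f (σ x)) →
    ∀ κ {u v} → Identifies κ X′ u v ⇔ Identifies κ X (substitute σ u) (substitute σ v)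
  pullback σ gen′≈ = transfer (substitute σ) (eval-substitute G gen σ gen′≈)

  regenerated-⊑ : (∀ x → gen′ x ≈ gen x) → X′ ⊑ X
  regenerated-⊑ gen′≈ κ = to (transfer (λ w → w) (eval-cong G gen gen′≈) κ)

  generated : ∀ τ → (∀ x → gen x ≈ RawMap.f X′ (τ x)) → Generated X → Generated X′
  generated τ gen≈ genX = record
    { elemWord      = substitute τ ∘ elemWord
    ; elemWord-spec = λ g → trans (sym (f≈ (elemWord g))) (elemWord-spec g)
    ; flagWord      = substitute τ ∘ flagWord
    ; flagWord-spec = λ z → transZ (act-cong reflZ (sym (f≈ (flagWord z)))) (flagWord-spec z)
    }
    where
    open Generated genX
    f≈ : ∀ w → f w ≈ RawMap.f X′ (substitute τ w)
    f≈ = eval-substitute G gen′ τ gen≈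

module Klein (G : Group 0ℓ 0ℓ) {a b : Group.Carrier G} where
  open Group G
  open GroupProperties G using (inverseˡ-unique; ⁻¹-anti-homo-∙)

  module _ (a² : a ∙ a ≈ ε) (b² : b ∙ b ≈ ε) (ab² : (a ∙ b) ∙ (a ∙ b) ≈ ε) where
    commute : a ∙ b ≈ b ∙ a
    commute = trans (inverseˡ-unique _ _ ab²)
      (trans (⁻¹-anti-homo-∙ a b) (∙-cong (sym (inverseˡ-unique b b b²)) (sym (inverseˡ-unique a a a²))))

    ba² : (b ∙ a) ∙ (b ∙ a) ≈ ε
    ba² = trans (∙-cong (sym commute) (sym commute)) ab²

    a∙ba≈b : a ∙ (b ∙ a) ≈ b
    a∙ba≈b = trans (∙-congˡ (sym commute)) (trans (sym (assoc a a b)) (trans (∙-congʳ a²) (identityˡ b)))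

record KleinRelations (A : RawMap) : Set where
  open RawMap A
  field
    t²  : gen gt ∙ gen gt ≈ ε
    l²  : gen gl ∙ gen gl ≈ ε
    tl² : (gen gt ∙ gen gl) ∙ (gen gt ∙ gen gl) ≈ ε

IsMap⇒KleinRelations : ∀ {A} → IsMap A → KleinRelations A
IsMap⇒KleinRelations isMap = record { t² = rel-t ; l² = rel-l ; tl² = rel-tl }
  where open IsMap isMap

opMap : Op → RawMap → RawMap
opMap du = Du
opMap pe = Pe

_⁺ _⁻ : Gen → Letter
x ⁺ = x , false
x ⁻ = x , true

opSubst : Op → Gen → FWord
opSubst du gt = [ gl ⁺ ]
opSubst du gl = [ gt ⁺ ]
opSubst du gr = [ gr ⁺ ]
opSubst pe gt = [ gt ⁺ ]
opSubst pe gl = gl ⁺ ∷ gt ⁺ ∷ []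
opSubst pe gr = [ gr ⁺ ]

opSubst⁻¹ : Op → Gen → FWord
opSubst⁻¹ du x  = opSubst du x
opSubst⁻¹ pe gt = [ gt ⁺ ]
opSubst⁻¹ pe gl = gl ⁺ ∷ gt ⁻ ∷ []
opSubst⁻¹ pe gr = [ gr ⁺ ]

module _ (X : RawMap) where
  open RawMap X
  open GroupProperties G using (//-rightDividesʳ)

  Du-gen : ∀ x → RawMap.gen (Du X) x ≈ f (opSubst du x)
  Du-gen gt = sym (identityʳ _)
  Du-gen gl = sym (identityʳ _)
  Du-gen gr = sym (identityʳ _)

  Pe-gen : ∀ x → RawMap.gen (Pe X) x ≈ f (opSubst pe x)
  Pe-gen gt = sym (identityʳ _)
  Pe-gen gl = ∙-congˡ (sym (identityʳ _))
  Pe-gen gr = sym (identityʳ _)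

  gen-Du : ∀ x → gen x ≈ RawMap.f (Du X) (opSubst⁻¹ du x)
  gen-Du gt = sym (identityʳ _)
  gen-Du gl = sym (identityʳ _)
  gen-Du gr = sym (identityʳ _)

  gen-Pe : ∀ x → gen x ≈ RawMap.f (Pe X) (opSubst⁻¹ pe x)
  gen-Pe gt = sym (identityʳ _)
  gen-Pe gl = sym (trans (∙-congˡ (identityʳ _)) (//-rightDividesʳ (gen gt) (gen gl)))
  gen-Pe gr = sym (identityʳ _)

opMap-pullback : ∀ o X κ {u v} →
  Identifies κ (opMap o X) u v ⇔ Identifies κ X (substitute (opSubst o) u) (substitute (opSubst o) v)
opMap-pullback du X = Regenerated.pullback X (RawMap.gen (Du X)) (opSubst du) (Du-gen X)
opMap-pullback pe X = Regenerated.pullback X (RawMap.gen (Pe X)) (opSubst pe) (Pe-gen X)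

opMap-generated : ∀ o {X} → Generated X → Generated (opMap o X)
opMap-generated du {X} = Regenerated.generated X (RawMap.gen (Du X)) (opSubst⁻¹ du) (gen-Du X)
opMap-generated pe {X} = Regenerated.generated X (RawMap.gen (Pe X)) (opSubst⁻¹ pe) (gen-Pe X)

opMap-kleinRelations : ∀ o {X} → KleinRelations X → KleinRelations (opMap o X)
opMap-kleinRelations du {X} klein = record { t² = l² ; l² = t² ; tl² = Klein.ba² G t² l² tl² }
  where
  open RawMap X
  open KleinRelations klein
opMap-kleinRelations pe {X} klein = record
  { t²  = t²
  ; l²  = Klein.ba² G t² l² tl²
  ; tl² = trans (∙-cong a∙ba≈b a∙ba≈b) l²
  }
  where
  open RawMap X
  open KleinRelations klein
  a∙ba≈b : gen gt ∙ (gen gl ∙ gen gt) ≈ gen gl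
  a∙ba≈b = Klein.a∙ba≈b G t² l² tl²

opMap-involutive : ∀ o {X} → KleinRelations X → opMap o (opMap o X) ⊑ X
opMap-involutive du {X} _ = Regenerated.regenerated-⊑ X (RawMap.gen (Du (Du X)))
  λ { gt → refl ; gl → refl ; gr → refl }
  where open RawMap X
opMap-involutive pe {X} klein = Regenerated.regenerated-⊑ X (RawMap.gen (Pe (Pe X)))
  λ { gt → refl ; gl → trans (assoc _ _ _) (trans (∙-congˡ t²) (identityʳ _)) ; gr → refl }
  where
  open RawMap X
  open KleinRelations klein

opMap-mono : ∀ o {A B} → A ⊑ B → opMap o A ⊑ opMap o B
opMap-mono o {A} {B} A⊑B κ p = from (opMap-pullback o B κ) (A⊑B κ (to (opMap-pullback o A κ) p))

⊑-opMap-ParAll : ∀ o k (L : Fin (suc k) → RawMap) {A} →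
  (∀ i → A ⊑ opMap o (L i)) → A ⊑ opMap o (ParAll k L)
⊑-opMap-ParAll o k L A⊑L κ p = from (opMap-pullback o (ParAll k L) κ)
  (ParAll-identifies k L κ (λ i → to (opMap-pullback o (L i) κ) (A⊑L i κ p)))

opMap-leftInvariant : ∀ o {A} → LeftInvariant A → LeftInvariant (opMap o A)
opMap-leftInvariant o {A} invariant c {u} {v} p = from (opMap-pullback o A flag)
  (≡.subst₂ (Identifies flag A) (≡.sym (concatMap-++ _ c u)) (≡.sym (concatMap-++ _ c v))
    (invariant (substitute (opSubst o) c) (to (opMap-pullback o A flag) p)))

applyOps-preserves : (P : RawMap → Set) → (∀ o {X} → P X → P (opMap o X)) →
  ∀ os {X} → P X → P (applyOps os X)
applyOps-preserves P step []        p = p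
applyOps-preserves P step (du ∷ os) p = step du (applyOps-preserves P step os p)
applyOps-preserves P step (pe ∷ os) p = step pe (applyOps-preserves P step os p)

⊑-applyOps : ∀ {M′ X} → (∀ o → M′ ⊑ opMap o M′) → M′ ⊑ X → ∀ os → M′ ⊑ applyOps os X
⊑-applyOps {M′} M′⊑opM′ M′⊑X os =
  applyOps-preserves (M′ ⊑_) (λ o M′⊑Y → ⊑-trans (M′⊑opM′ o) (opMap-mono o M′⊑Y)) os M′⊑X

ParAll-opMap-invariant : ∀ o k (L : Fin (suc k) → RawMap) →
  Generated (L zero) → (∀ i → KleinRelations (L i)) → (∀ j → ∃ λ i → Isomorphism (opMap o (L j)) (L i)) →
  Isomorphism (opMap o (ParAll k L)) (ParAll k L)
ParAll-opMap-invariant o k L gen₀ klein closed =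
  ⊑⇒Isomorphism (opMap-generated o genN) genN opN⊑N N⊑opN
  where
  genN : Generated (ParAll k L)
  genN = ParAll-generated k L gen₀

  opN⊑N : opMap o (ParAll k L) ⊑ ParAll k L
  opN⊑N = ⊑-ParAll k L λ j → let (i , opLⱼ≅Lᵢ) = closed j in
    ⊑-trans (opMap-mono o (ParAll-⊑ k L i))
      (⊑-trans (opMap-mono o (isomorphism⇒⊒ opLⱼ≅Lᵢ)) (opMap-involutive o (klein j)))

  N⊑opN : ParAll k L ⊑ opMap o (ParAll k L)
  N⊑opN = ⊑-opMap-ParAll o k L λ j → let (i , opLⱼ≅Lᵢ) = closed j in
    ⊑-trans (ParAll-⊑ k L i) (isomorphism⇒⊒ opLⱼ≅Lᵢ)

proposition12 :
    (M : RawMap) → IsMap M → FiniteMap M → Reflexible M →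
    (k : ℕ) (ops : Fin (suc k) → List Op) →
    (∀ (os : List Op) → ∃ λ i → Isomorphism (applyOps os M) (applyOps (ops i) M)) →
    (∀ i j → i ≢ j → ¬ Isomorphism (applyOps (ops i) M) (applyOps (ops j) M)) →
    TotallySymmetric (ParAll k (λ i → applyOps (ops i) M)) ×
    Covers (ParAll k (λ i → applyOps (ops i) M)) M ×
    (∀ (M′ : RawMap) → IsMap M′ → FiniteMap M′ → TotallySymmetric M′ → Covers M′ M →
       Covers M′ (ParAll k (λ i → applyOps (ops i) M)))
proposition12 M isMap _ reflexible k ops images _ =
  (LeftInvariant⇒Reflexible genN invariantN , opN≅N du , opN≅N pe) , N-covers-M , minimal
  where
  Mᵢ : Fin (suc k) → RawMap
  Mᵢ i = applyOps (ops i) M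

  genM : Generated M
  genM = IsMap⇒Generated isMap

  genM₀ : Generated (Mᵢ zero)
  genM₀ = applyOps-preserves Generated opMap-generated (ops zero) genM

  genN : Generated (ParAll k Mᵢ)
  genN = ParAll-generated k Mᵢ genM₀

  invariantN : LeftInvariant (ParAll k Mᵢ)
  invariantN = ParAll-leftInvariant k Mᵢ λ i →
    applyOps-preserves LeftInvariant opMap-leftInvariant (ops i) (Reflexible⇒LeftInvariant reflexible)

  closed : ∀ o j → ∃ λ i → Isomorphism (opMap o (Mᵢ j)) (Mᵢ i)
  closed du j = images (du ∷ ops j)
  closed pe j = images (pe ∷ ops j)

  opN≅N : ∀ o → Isomorphism (opMap o (ParAll k Mᵢ)) (ParAll k Mᵢ)
  opN≅N o = ParAll-opMap-invariant o k Mᵢ genM₀ klein (closed o)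
    where
    klein : ∀ i → KleinRelations (Mᵢ i)
    klein i = applyOps-preserves KleinRelations opMap-kleinRelations (ops i) (IsMap⇒KleinRelations isMap)

  N-covers-M : Covers (ParAll k Mᵢ) M
  N-covers-M = let (i , M≅Mᵢ) = images [] in
    ⊑⇒Morphism genN genM (⊑-trans (ParAll-⊑ k Mᵢ i) (isomorphism⇒⊒ M≅Mᵢ))

  minimal : ∀ M′ → IsMap M′ → FiniteMap M′ → TotallySymmetric M′ → Covers M′ M → Covers M′ (ParAll k Mᵢ)
  minimal M′ isMap′ _ (_ , Du≅ , Pe≅) M′-covers-M = ⊑⇒Morphism (IsMap⇒Generated isMap′) genN
    (⊑-ParAll k Mᵢ λ i → ⊑-applyOps M′⊑opM′ (morphism⇒⊑ M′-covers-M) (ops i))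
    where
    M′⊑opM′ : ∀ o → M′ ⊑ opMap o M′
    M′⊑opM′ du = isomorphism⇒⊒ Du≅
    M′⊑opM′ pe = isomorphism⇒⊒ Pe≅
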